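{- Let $\mathcal{F}$ be a maximal intersecting $r$-graph on $[n]$ and let $S(\mathcal{F})$ be any shift of $\mathcal{F}$. Then $\mathrm{Gen}(n,r,S(\mathcal{F}))=\mathcal{F}$.
   Context: An intersecting $r$-graph $\mathcal{F}$ on $[n]$ is maximal if for every $A\in\binom{[n]}{r}\setminus\mathcal{F}$ there is $B\in\mathcal{F}$ with $A\cap B=\emptyset$. A shift of an intersecting family $\mathcal{F}$ is any family obtained by repeatedly, as long as there exist $A\in\mathcal{F}$, $i\in A$ with $(\mathcal{F}\setminus\{A\})\cup\{A\setminus\{i\}\}$ intersecting, replacing $\mathcal{F}$ by that family; stop when no such move exists. For a family $\mathcal{G}$ of subsets of $[n]$, $\mathrm{Gen}(n,r,\mathcal{G})=\{A\in\binom{[n]}{r}:\exists G\in\mathcal{G},\ A\supseteq G\}$. -}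

module Defs where

open import Data.Nat using (ℕ)
open import Data.Bool using (Bool; true; false; _∧_; _∨_; not)
import Data.Bool as B
open import Data.Fin using (Fin)
open import Data.Fin.Subset using (Subset; _∈_; _∩_; _-_; ∣_∣; _⊆_; Nonempty; Empty)
open import Data.Vec.Properties using (≡-dec)
open import Data.Product using (Σ; ∃; _×_)
open import Relation.Nullary using (¬_)
open import Relation.Nullary.Decidable using (⌊_⌋)
open import Relation.Binary.PropositionalEquality using (_≡_)
open import Relation.Binary.Construct.Closure.ReflexiveTransitive using (Star)

Family : ℕ → Set
Family n = Subset n → Bool

_∈F_ : ∀ {n} → Subset n → Family n → Set
A ∈F 𝓕 = 𝓕 A ≡ true

_==_ : ∀ {n} → Subset n → Subset n → Bool
X == Y = ⌊ ≡-dec B._≟_ X Y ⌋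

Intersecting : ∀ {n} → Family n → Set
Intersecting 𝓕 = ∀ A B → A ∈F 𝓕 → B ∈F 𝓕 → Nonempty (A ∩ B)

Uniform : ∀ {n} → ℕ → Family n → Set
Uniform r 𝓕 = ∀ A → A ∈F 𝓕 → ∣ A ∣ ≡ r

MaximalIntersecting : ∀ {n} → ℕ → Family n → Set
MaximalIntersecting {n} r 𝓕 =
  Uniform r 𝓕 × Intersecting 𝓕 ×
  (∀ (A : Subset n) → ∣ A ∣ ≡ r → ¬ (A ∈F 𝓕) → ∃ λ B → B ∈F 𝓕 × Empty (A ∩ B))

replace : ∀ {n} → Family n → Subset n → Fin n → Family n
replace 𝓕 A i X = (𝓕 X ∧ not (X == A)) ∨ (X == (A - i))

data Move {n} (𝓕 : Family n) : Family n → Set where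
  move : (A : Subset n) (i : Fin n) → A ∈F 𝓕 → i ∈ A →
         Intersecting (replace 𝓕 A i) → Move 𝓕 (replace 𝓕 A i)

Terminal : ∀ {n} → Family n → Set
Terminal 𝓕 = ∀ 𝓖 → ¬ Move 𝓕 𝓖

IsShift : ∀ {n} → Family n → Family n → Set
IsShift 𝓕 𝓢 = Star Move 𝓕 𝓢 × Terminal 𝓢

InGen : ∀ {n} → ℕ → Family n → Subset n → Set
InGen r 𝓖 A = ∣ A ∣ ≡ r × ∃ λ G → G ∈F 𝓖 × G ⊆ A

-- A shifting move replaces a set by a subset of it, so every member of 𝓕 keeps
-- containing a member of the current family, which stays intersecting throughout.
-- Hence 𝓕 ⊆ Gen(S(𝓕)). Conversely, if an r-set A ∉ 𝓕 contained some G ∈ S(𝓕),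
-- maximality gives B ∈ 𝓕 disjoint from A; but B contains some G' ∈ S(𝓕), and
-- G ∩ G' ≠ ∅ would lie in A ∩ B.
module Submission where

open import Defs
open import Data.Nat using (ℕ)
open import Data.Bool using (true; false)
import Data.Bool as B
open import Data.Bool.Properties using (∨-zeroʳ)
open import Data.Empty using (⊥-elim)
open import Data.Fin using (Fin)
open import Data.Fin.Subset using (Subset; _∩_; _-_; _⊆_; Nonempty)
open import Data.Fin.Subset.Properties using (x∈p∩q⁺; x∈p∩q⁻; p─q⊆p; ⊆-refl; ⊆-trans)
open import Data.Product using (∃; _×_; _,_)
open import Data.Vec.Properties using (≡-dec)
open import Function using (id)
open import Relation.Nullary using (yes; no)
open import Relation.Binary.PropositionalEquality using (_≡_; _≢_; refl)
open import Relation.Binary.Construct.Closure.ReflexiveTransitive using (Star; fold)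

private
  variable
    n : ℕ

==-refl : (X : Subset n) → (X == X) ≡ true
==-refl X with ≡-dec B._≟_ X X
... | yes _ = refl
... | no X≢X = ⊥-elim (X≢X refl)

==-≢ : {X Y : Subset n} → X ≢ Y → (X == Y) ≡ false
==-≢ {X = X} {Y} X≢Y with ≡-dec B._≟_ X Y
... | yes X≡Y = ⊥-elim (X≢Y X≡Y)
... | no _ = refl

replace-new : (𝓖 : Family n) (A : Subset n) (i : Fin n) → (A - i) ∈F replace 𝓖 A i
replace-new 𝓖 A i rewrite ==-refl (A - i) = ∨-zeroʳ _

replace-old : (𝓖 : Family n) (A : Subset n) (i : Fin n) {X : Subset n} →
              X ∈F 𝓖 → X ≢ A → X ∈F replace 𝓖 A i
replace-old 𝓖 A i X∈𝓖 X≢A rewrite X∈𝓖 | ==-≢ X≢A = refl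

_∈↑_ : Subset n → Family n → Set
F ∈↑ 𝓖 = ∃ λ G → G ∈F 𝓖 × G ⊆ F

_⊆↑_ : Family n → Family n → Set
𝓕 ⊆↑ 𝓖 = ∀ F → F ∈F 𝓕 → F ∈↑ 𝓖

⊆↑-refl : (𝓕 : Family n) → 𝓕 ⊆↑ 𝓕
⊆↑-refl 𝓕 F F∈𝓕 = F , F∈𝓕 , ⊆-refl

⊆↑-trans : {𝓕 𝓖 𝓗 : Family n} → 𝓕 ⊆↑ 𝓖 → 𝓖 ⊆↑ 𝓗 → 𝓕 ⊆↑ 𝓗
⊆↑-trans 𝓕⊆↑𝓖 𝓖⊆↑𝓗 F F∈𝓕 with 𝓕⊆↑𝓖 F F∈𝓕
... | G , G∈𝓖 , G⊆F with 𝓖⊆↑𝓗 G G∈𝓖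
... | H , H∈𝓗 , H⊆G = H , H∈𝓗 , ⊆-trans H⊆G G⊆F

Move⇒⊆↑ : {𝓖 𝓗 : Family n} → Move 𝓖 𝓗 → 𝓖 ⊆↑ 𝓗
Move⇒⊆↑ {𝓖 = 𝓖} (move A i _ _ _) G G∈𝓖 with ≡-dec B._≟_ G A
... | yes refl = A - i , replace-new 𝓖 A i , p─q⊆p A _
... | no G≢A = G , replace-old 𝓖 A i G∈𝓖 G≢A , ⊆-refl

Move⇒Intersecting : {𝓖 𝓗 : Family n} → Move 𝓖 𝓗 → Intersecting 𝓗
Move⇒Intersecting (move _ _ _ _ intersecting) = intersecting

Moves⇒⊆↑ : {𝓖 𝓗 : Family n} → Star Move 𝓖 𝓗 → 𝓖 ⊆↑ 𝓗
Moves⇒⊆↑ = fold _⊆↑_ (λ m → ⊆↑-trans (Move⇒⊆↑ m)) (⊆↑-refl _)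

Moves-preserve-Intersecting : {𝓖 𝓗 : Family n} → Star Move 𝓖 𝓗 →
                              Intersecting 𝓖 → Intersecting 𝓗
Moves-preserve-Intersecting =
  fold (λ 𝓖 𝓗 → Intersecting 𝓖 → Intersecting 𝓗) (λ m keep _ → keep (Move⇒Intersecting m)) id

∩-mono-Nonempty : {G G′ A B : Subset n} → G ⊆ A → G′ ⊆ B →
                  Nonempty (G ∩ G′) → Nonempty (A ∩ B)
∩-mono-Nonempty {G = G} {G′} G⊆A G′⊆B (x , x∈G∩G′) with x∈p∩q⁻ G G′ x∈G∩G′
... | x∈G , x∈G′ = x , x∈p∩q⁺ (G⊆A x∈G , G′⊆B x∈G′)

InGen⇒∈-maximal : {r : ℕ} {𝓕 𝓖 : Family n} → MaximalIntersecting r 𝓕 →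
                  Intersecting 𝓖 → 𝓕 ⊆↑ 𝓖 →
                  (A : Subset n) → InGen r 𝓖 A → A ∈F 𝓕
InGen⇒∈-maximal {𝓕 = 𝓕} (_ , _ , maximal) 𝓖-intersecting 𝓕⊆↑𝓖 A (∣A∣≡r , G , G∈𝓖 , G⊆A)
  with 𝓕 A B.≟ true
... | yes A∈𝓕 = A∈𝓕
... | no A∉𝓕 with maximal A ∣A∣≡r A∉𝓕
... | B , B∈𝓕 , A∩B-empty with 𝓕⊆↑𝓖 B B∈𝓕
... | G′ , G′∈𝓖 , G′⊆B =
  ⊥-elim (A∩B-empty (∩-mono-Nonempty G⊆A G′⊆B (𝓖-intersecting G G′ G∈𝓖 G′∈𝓖)))

lemma2p7 : (n r : ℕ) (𝓕 𝓢 : Family n) → MaximalIntersecting r 𝓕 → IsShift 𝓕 𝓢 →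
    (A : Subset n) → (InGen r 𝓢 A → A ∈F 𝓕) × (A ∈F 𝓕 → InGen r 𝓢 A)
lemma2p7 n r 𝓕 𝓢 𝓕-maximal@(uniform , intersecting , _) (moves , _) A =
  InGen⇒∈-maximal 𝓕-maximal (Moves-preserve-Intersecting moves intersecting) 𝓕⊆↑𝓢 A ,
  λ A∈𝓕 → uniform A A∈𝓕 , 𝓕⊆↑𝓢 A A∈𝓕
  where
  𝓕⊆↑𝓢 : 𝓕 ⊆↑ 𝓢
  𝓕⊆↑𝓢 = Moves⇒⊆↑ moves
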